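{- Let $h\in\mathbb N$, $u,v\in\mathfrak S_n$ with $u<v$, and $F$ an $h$-flipclass of paths from $u$ to $v$. Suppose that for all $i\in[h-1]$ and all $(a,i-1),(b,i+1)\in V(TS_F)$, the interval $[(a,i-1),(b,i+1)]$ in the poset induced by $TS_F$, if nonempty, is a diamond. For $i\in[h-1]$ define $f'_i$ on the set $P$ of directed paths of length $h$ from $(u,0)$ to $(v,h)$ in $TS_F$ by sending $(u,0)\to\cdots\to(a_{i-1},i-1)\to(a_i,i)\to(a_{i+1},i+1)\to\cdots\to(v,h)$ to the path obtained by replacing $(a_i,i)$ with the other middle element of the diamond $[(a_{i-1},i-1),(a_{i+1},i+1)]$. Then $f'_i$ is well defined and $i_{TS_F}\circ f_i=f'_i\circ i_{TS_F}$ on $F$ for every $i\in[h-1]$ (i.e. $i_{TS_F}$ is equivariant with respect to the flip operators).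
   Context: $\mathfrak S_n$: symmetric group on $[n]$, $\ell$ Coxeter length, $T$ transpositions. Bruhat graph: edge $x\to y$ whenever $yx^{ -1}\in T$ and $\ell(x)<\ell(y)$. $P_h(u,v)$: directed paths of length $h$ from $u$ to $v$. Between two elements there are 0 or 2 paths of length 2, each the flip of the other; $f_i$ replaces the subpath $x_{i-1}\to x_i\to x_{i+1}$ by its flip; the $h$-flipclasses of paths from $u$ to $v$ are the orbits in $P_h(u,v)$ of the group generated by $f_1,\dots,f_{h-1}$. The time-support graph $TS_F$ has vertices $(a,j)$ such that some path $x_0\to\cdots\to x_h$ of $F$ has $x_j=a$, and an edge $(a,j)\to(b,j+1)$ whenever some path of $F$ has $x_j=a,x_{j+1}=b$; it is acyclic and induces a partial order on its vertices ($\bar x\le\bar y$ iff there is a directed path from $\bar x$ to $\bar y$). The map $i_{TS_F}$ sends $x_0\to\cdots\to x_h\in F$ to $(x_0,0)\to(x_1,1)\to\cdots\to(x_h,h)$. A poset is a diamond if it consists of a minimum, a maximum and exactly two incomparable elements in between. -}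

module Defs where

open import Data.Nat using (ℕ; zero; suc; _+_; _<_; _≤_)
open import Data.Fin using (Fin; zero; suc; toℕ; inject₁; fromℕ; _≟_; _<?_)
open import Data.Vec using (Vec; []; _∷_; lookup; map; tabulate; toList)
open import Data.List using (length; filter)
open import Data.Maybe using (Maybe; just; nothing)
open import Data.Product using (Σ; ∃; ∃-syntax; _×_; _,_)
open import Data.Sum using (_⊎_)
open import Relation.Nullary using (¬_; yes; no)
open import Relation.Binary.PropositionalEquality using (_≡_; _≢_)
open import Relation.Binary.Construct.Closure.ReflexiveTransitive using (Star)

-- The symmetric group 𝔖_n: a permutation w is stored in one-line
-- notation as the vector (w(0), …, w(n-1)).

Word : ℕ → Set
Word n = Vec (Fin n) n

IsPerm : ∀ {n} → Word n → Set
IsPerm {n} w = ∀ (i j : Fin n) → lookup w i ≡ lookup w j → i ≡ j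

swap : ∀ {n} → Fin n → Fin n → Fin n → Fin n
swap a b c with c ≟ a
... | yes _ = b
... | no _ with c ≟ b
...   | yes _ = a
...   | no _  = c

-- Coxeter length in 𝔖_n = number of inversions
inv : ∀ {n m} → Vec (Fin n) m → ℕ
inv []       = 0
inv (a ∷ xs) = length (filter (λ b → b <? a) (toList xs)) + inv xs

ℓ : ∀ {n} → Word n → ℕ
ℓ = inv

-- Bruhat graph edge x → y : y x⁻¹ = t ∈ T (i.e. y = t ∘ x) and ℓ(x) < ℓ(y)
BEdge : ∀ {n} → Word n → Word n → Set
BEdge {n} x y =
  (∃[ a ] ∃[ b ] (a ≢ b × y ≡ map (swap a b) x)) × ℓ x < ℓ y

at : ∀ {A : Set} {m} → Vec A m → ℕ → Maybe A
at []       _       = nothing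
at (x ∷ xs) zero    = just x
at (x ∷ xs) (suc k) = at xs k

BPath : ∀ {n} (h : ℕ) → Word n → Word n → Vec (Word n) (suc h) → Set
BPath h u v p =
  lookup p zero ≡ u × lookup p (fromℕ h) ≡ v ×
  (∀ (j : Fin h) → BEdge (lookup p (inject₁ j)) (lookup p (suc j)))

BruhatLt : ∀ {n} → Word n → Word n → Set
BruhatLt {n} u v = ∃[ h ] (0 < h × ∃[ p ] BPath {n} h u v p)

DifferOnlyAt : ∀ {A : Set} {m} → ℕ → Vec A m → Vec A m → Set
DifferOnlyAt i p q = (∀ j → j ≢ i → at p j ≡ at q j) × at p i ≢ at q i

-- f_i (i ∈ [h-1]), as its graph: q = f_i(p) iff q ∈ P_h(u,v) differs
-- from p ∈ P_h(u,v) exactly in the vertex x_i (there are exactly two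
-- paths x_{i-1} → · → x_{i+1}, so the other one is the flip).
Flip : ∀ {n} (h : ℕ) (u v : Word n) (i : ℕ) → Vec (Word n) (suc h) → Vec (Word n) (suc h) → Set
Flip h u v i p q =
  1 ≤ i × suc i ≤ h × BPath h u v p × BPath h u v q × DifferOnlyAt i p q

-- one step of the action of ⟨f_1,…,f_{h-1}⟩ (the f_i are involutions)
AnyFlip : ∀ {n} (h : ℕ) (u v : Word n) → Vec (Word n) (suc h) → Vec (Word n) (suc h) → Set
AnyFlip h u v p q = ∃[ i ] Flip h u v i p q

IsFlipclass : ∀ {n} (h : ℕ) (u v : Word n) → (Vec (Word n) (suc h) → Set) → Set
IsFlipclass h u v F =
  ∃[ p₀ ] (BPath h u v p₀ ×
    (∀ q → (F q → Star (AnyFlip h u v) p₀ q) × (Star (AnyFlip h u v) p₀ q → F q)))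

TSVertex : ∀ {n h} → (Vec (Word n) (suc h) → Set) → Word n × ℕ → Set
TSVertex F (a , j) = ∃[ p ] (F p × at p j ≡ just a)

TSEdge : ∀ {n h} → (Vec (Word n) (suc h) → Set) → Word n × ℕ → Word n × ℕ → Set
TSEdge F (a , j) (b , k) =
  k ≡ suc j × ∃[ p ] (F p × at p j ≡ just a × at p (suc j) ≡ just b)

TSLe : ∀ {n h} → (Vec (Word n) (suc h) → Set) → Word n × ℕ → Word n × ℕ → Set
TSLe F = Star (TSEdge F)

Interval : ∀ {n h} → (Vec (Word n) (suc h) → Set) → Word n × ℕ → Word n × ℕ → Word n × ℕ → Set
Interval F x y z = TSVertex F z × TSLe F x z × TSLe F z y

record DiamondWithMiddles {A : Set} (S : A → Set) (_≤'_ : A → A → Set) (m₁ m₂ : A) : Set where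
  field
    bot top : A
    bot∈ : S bot
    top∈ : S top
    m₁∈  : S m₁
    m₂∈  : S m₂
    bot≢top : bot ≢ top
    bot≢m₁  : bot ≢ m₁
    bot≢m₂  : bot ≢ m₂
    top≢m₁  : top ≢ m₁
    top≢m₂  : top ≢ m₂
    m₁≢m₂   : m₁ ≢ m₂
    minimum : ∀ z → S z → bot ≤' z
    maximum : ∀ z → S z → z ≤' top
    incomp₁ : ¬ (m₁ ≤' m₂)
    incomp₂ : ¬ (m₂ ≤' m₁)
    only    : ∀ z → S z → (z ≡ bot ⊎ z ≡ top) ⊎ (z ≡ m₁ ⊎ z ≡ m₂)

IsDiamond : {A : Set} (S : A → Set) (_≤'_ : A → A → Set) → Set
IsDiamond S _≤'_ = ∃[ m₁ ] ∃[ m₂ ] DiamondWithMiddles S _≤'_ m₁ m₂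

TSPath : ∀ {n} (h : ℕ) → (Vec (Word n) (suc h) → Set) → Word n → Word n → Vec (Word n × ℕ) (suc h) → Set
TSPath h F u v P =
  lookup P zero ≡ (u , 0) × lookup P (fromℕ h) ≡ (v , h) ×
  (∀ (j : Fin h) → TSEdge F (lookup P (inject₁ j)) (lookup P (suc j)))

ιTS : ∀ {n h} → Vec (Word n) (suc h) → Vec (Word n × ℕ) (suc h)
ιTS p = tabulate (λ j → (lookup p j , toℕ j))

F'Rel : ∀ {n h} → (Vec (Word n) (suc h) → Set) → ℕ → Vec (Word n × ℕ) (suc h) → Vec (Word n × ℕ) (suc h) → Set
F'Rel F i P P' =
  (∀ j → j ≢ i → at P j ≡ at P' j) ×
  ∃[ x ] ∃[ y ] ∃[ c ] ∃[ d ]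
    (i ≡ suc (Data.Nat.pred i) × at P (Data.Nat.pred i) ≡ just x × at P (suc i) ≡ just y ×
     at P i ≡ just c × at P' i ≡ just d ×
     DiamondWithMiddles (Interval F x y) (TSLe F) c d)

{-# OPTIONS --safe #-}
module Submission where

-- Every edge of TS_F raises the time coordinate by one, so the order induced by TS_F is
-- antisymmetric and an interval [(a,i-1),(b,i+1)] through a path vertex (c,i) has minimum
-- (a,i-1) and maximum (b,i+1). Its middle elements then lie at time i and are joined to
-- both ends by edges, so swapping (c,i) for the other middle element of the diamond gives
-- again a path of TS_F, and antisymmetry makes that element unique. If q = f_i(p) then q
-- lies in F as well, so (p_i,i) and (q_i,i) are two distinct middle elements of the same
-- diamond, which is the equivariance.

open import Defs
open import Data.Nat using (ℕ; zero; suc; _≤_; _<_; _∸_; z≤n; s≤s; s≤s⁻¹)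
open import Data.Nat.Properties
  using ( _≟_; ≤-reflexive; ≤-antisym; <-irrefl; <-asym; <-trans; <⇒≤; <⇒≢; n<1+n; m≤n⇒m≤1+n
        ; 1+n≢n; suc-injective)
open import Data.Fin using (Fin; toℕ; fromℕ<; inject₁; fromℕ) renaming (zero to fzero; suc to fsuc)
open import Data.Fin.Properties using (toℕ-fromℕ<; toℕ<n)
open import Data.Vec using (Vec; []; _∷_; lookup; tabulate)
open import Data.Maybe as Maybe using (just)
open import Data.Maybe.Properties using (just-injective)
open import Data.Product using (∃; ∃-syntax; _×_; _,_; proj₁; proj₂)
open import Data.Sum using (_⊎_; inj₁; inj₂)
open import Data.Empty using (⊥-elim)
open import Relation.Nullary using (yes; no)
open import Relation.Binary.Definitions using (Antisymmetric)
open import Relation.Binary.PropositionalEquality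
  using (_≡_; _≢_; refl; sym; trans; cong; subst; subst₂; ≢-sym)
open import Relation.Binary.Construct.Closure.ReflexiveTransitive using (Star; ε; _◅_; _◅◅_)

open DiamondWithMiddles

module _ {A : Set} where

  at-toℕ : ∀ {m} (P : Vec A m) (j : Fin m) → at P (toℕ j) ≡ just (lookup P j)
  at-toℕ (x ∷ P) fzero    = refl
  at-toℕ (x ∷ P) (fsuc j) = at-toℕ P j

  at-inject₁ : ∀ {m} (P : Vec A (suc m)) (j : Fin m) → at P (toℕ j) ≡ just (lookup P (inject₁ j))
  at-inject₁ (x ∷ P)     fzero    = refl
  at-inject₁ (x ∷ y ∷ P) (fsuc j) = at-inject₁ (y ∷ P) j

  at-fromℕ : ∀ m (P : Vec A (suc m)) → at P m ≡ just (lookup P (fromℕ m))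
  at-fromℕ zero    (x ∷ P) = refl
  at-fromℕ (suc m) (x ∷ P) = at-fromℕ m P

  at-< : ∀ {m} (P : Vec A m) {k} → k < m → ∃[ a ] at P k ≡ just a
  at-< (x ∷ P) {zero}  _         = x , refl
  at-< (x ∷ P) {suc k} (s≤s k<m) = at-< P k<m

  at-just⇒< : ∀ {m} (P : Vec A m) {k a} → at P k ≡ just a → k < m
  at-just⇒< (x ∷ P) {zero}  _  = s≤s z≤n
  at-just⇒< (x ∷ P) {suc k} eq = s≤s (at-just⇒< P eq)

  at-injective : ∀ {m} {P Q : Vec A m} → (∀ k → at P k ≡ at Q k) → P ≡ Q
  at-injective {P = []}    {[]}    _  = refl
  at-injective {P = x ∷ P} {y ∷ Q} eq with just-injective (eq 0)
  ... | refl = cong (x ∷_) (at-injective (λ k → eq (suc k)))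

  -- Unlike _[_]≔_ of Data.Vec, indexed by ℕ (as at is); an out-of-range index changes nothing.
  replace : ∀ {m} → Vec A m → ℕ → A → Vec A m
  replace []      _       _ = []
  replace (x ∷ P) zero    a = a ∷ P
  replace (x ∷ P) (suc i) a = x ∷ replace P i a

  at-replace-≡ : ∀ {m} (P : Vec A m) {i} a → i < m → at (replace P i a) i ≡ just a
  at-replace-≡ (x ∷ P) {zero}  a _         = refl
  at-replace-≡ (x ∷ P) {suc i} a (s≤s i<m) = at-replace-≡ P a i<m

  at-replace-≢ : ∀ {m} (P : Vec A m) {i} a {j} → j ≢ i → at (replace P i a) j ≡ at P j
  at-replace-≢ []      a         _   = refl
  at-replace-≢ (x ∷ P) {zero}  a {zero}  j≢i = ⊥-elim (j≢i refl)
  at-replace-≢ (x ∷ P) {zero}  a {suc j} _   = refl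
  at-replace-≢ (x ∷ P) {suc i} a {zero}  _   = refl
  at-replace-≢ (x ∷ P) {suc i} a {suc j} j≢i = at-replace-≢ P a (λ j≡i → j≢i (cong suc j≡i))

at-tabulate-lookup : ∀ {A B : Set} {m} (p : Vec A m) (g : ℕ → B) k →
  at (tabulate (λ j → lookup p j , g (toℕ j))) k ≡ Maybe.map (_, g k) (at p k)
at-tabulate-lookup []      g k       = refl
at-tabulate-lookup (a ∷ p) g zero    = refl
at-tabulate-lookup (a ∷ p) g (suc k) = at-tabulate-lookup p (λ j → g (suc j)) k

at-ιTS : ∀ {n h} (p : Vec (Word n) (suc h)) k → at (ιTS p) k ≡ Maybe.map (_, k) (at p k)
at-ιTS p = at-tabulate-lookup p (λ k → k)

at-ιTS-just : ∀ {n h} (p : Vec (Word n) (suc h)) {k a} →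
  at p k ≡ just a → at (ιTS p) k ≡ just (a , k)
at-ιTS-just p {k} pₖ≡a = trans (at-ιTS p k) (cong (Maybe.map (_, k)) pₖ≡a)

at-ιTS-cong : ∀ {n h} (p q : Vec (Word n) (suc h)) {k} →
  at p k ≡ at q k → at (ιTS p) k ≡ at (ιTS q) k
at-ιTS-cong p q {k} pₖ≡qₖ =
  trans (at-ιTS p k) (trans (cong (Maybe.map (_, k)) pₖ≡qₖ) (sym (at-ιTS q k)))

flipclass-closed : ∀ {n h u v F i p q} → IsFlipclass {n} h u v F → F p → Flip h u v i p q → F q
flipclass-closed {p = p} {q} (_ , _ , orbit) Fp flip =
  proj₂ (orbit q) (proj₁ (orbit p) Fp ◅◅ (_ , flip) ◅ ε)

module _ {A : Set} {S : A → Set} {_≤_ : A → A → Set} {m₁ m₂ : A}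
         (D : DiamondWithMiddles S _≤_ m₁ m₂) where

  swap-middles : DiamondWithMiddles S _≤_ m₂ m₁
  swap-middles = record
    { bot = bot D ; top = top D ; bot∈ = bot∈ D ; top∈ = top∈ D
    ; m₁∈ = m₂∈ D ; m₂∈ = m₁∈ D
    ; bot≢top = bot≢top D ; bot≢m₁ = bot≢m₂ D ; bot≢m₂ = bot≢m₁ D
    ; top≢m₁ = top≢m₂ D ; top≢m₂ = top≢m₁ D ; m₁≢m₂ = ≢-sym (m₁≢m₂ D)
    ; minimum = minimum D ; maximum = maximum D ; incomp₁ = incomp₂ D ; incomp₂ = incomp₁ D
    ; only = λ z z∈ → swap-middle (only D z z∈) }
    where
      swap-middle : ∀ {P Q R T : Set} → (P ⊎ Q) ⊎ (R ⊎ T) → (P ⊎ Q) ⊎ (T ⊎ R)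
      swap-middle (inj₁ end)        = inj₁ end
      swap-middle (inj₂ (inj₁ z≡m)) = inj₂ (inj₂ z≡m)
      swap-middle (inj₂ (inj₂ z≡m)) = inj₂ (inj₁ z≡m)

  IsInner : A → Set
  IsInner c = S c × c ≢ bot D × c ≢ top D

  inner⇒middle : ∀ {c} → IsInner c → c ≡ m₁ ⊎ c ≡ m₂
  inner⇒middle (c∈ , c≢bot , c≢top) with only D _ c∈
  ... | inj₁ (inj₁ c≡bot) = ⊥-elim (c≢bot c≡bot)
  ... | inj₁ (inj₂ c≡top) = ⊥-elim (c≢top c≡top)
  ... | inj₂ c≡m          = c≡m

  other-middle : ∀ {c} → IsInner c → ∃[ d ] DiamondWithMiddles S _≤_ c d
  other-middle c-inner with inner⇒middle c-inner
  ... | inj₁ refl = m₂ , D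
  ... | inj₂ refl = m₁ , swap-middles

  diamond-with-middles : ∀ {c d} → IsInner c → IsInner d → c ≢ d → DiamondWithMiddles S _≤_ c d
  diamond-with-middles c-inner d-inner c≢d with inner⇒middle c-inner | inner⇒middle d-inner
  ... | inj₁ refl | inj₁ refl = ⊥-elim (c≢d refl)
  ... | inj₁ refl | inj₂ refl = D
  ... | inj₂ refl | inj₁ refl = swap-middles
  ... | inj₂ refl | inj₂ refl = ⊥-elim (c≢d refl)

module _ {A : Set} {S : A → Set} {_≤_ : A → A → Set} (antisym : Antisymmetric _≡_ _≤_) where

  bot-unique : ∀ {m₁ m₂ m₁′ m₂′} (D : DiamondWithMiddles S _≤_ m₁ m₂)
    (D′ : DiamondWithMiddles S _≤_ m₁′ m₂′) → bot D ≡ bot D′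
  bot-unique D D′ = antisym (minimum D _ (bot∈ D′)) (minimum D′ _ (bot∈ D))

  top-unique : ∀ {m₁ m₂ m₁′ m₂′} (D : DiamondWithMiddles S _≤_ m₁ m₂)
    (D′ : DiamondWithMiddles S _≤_ m₁′ m₂′) → top D ≡ top D′
  top-unique D D′ = antisym (maximum D′ _ (top∈ D)) (maximum D _ (top∈ D′))

  other-middle-unique : ∀ {c d d′} →
    DiamondWithMiddles S _≤_ c d → DiamondWithMiddles S _≤_ c d′ → d ≡ d′
  other-middle-unique {d′ = d′} D D′ with inner⇒middle D (m₂∈ D′ , d′≢bot , d′≢top)
    where
      d′≢bot : d′ ≢ bot D
      d′≢bot d′≡bot = bot≢m₂ D′ (trans (bot-unique D′ D) (sym d′≡bot))
      d′≢top : d′ ≢ top D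
      d′≢top d′≡top = top≢m₂ D′ (trans (top-unique D′ D) (sym d′≡top))
  ... | inj₁ d′≡c = ⊥-elim (m₁≢m₂ D′ (sym d′≡c))
  ... | inj₂ d′≡d = sym d′≡d

module TimeSupport {n h : ℕ} (F : Vec (Word n) (suc h) → Set) where

  time : Word n × ℕ → ℕ
  time = proj₂

  TSEdge⇒< : ∀ {s t} → TSEdge F s t → time s < time t
  TSEdge⇒< (t≡1+s , _) = ≤-reflexive (sym t≡1+s)

  TSEdge⇒≢ : ∀ {s t} → TSEdge F s t → s ≢ t
  TSEdge⇒≢ (t≡1+s , _) s≡t = 1+n≢n (trans (sym t≡1+s) (cong time (sym s≡t)))

  TSEdge-source : ∀ {s t} → TSEdge F s t → TSVertex F s
  TSEdge-source (_ , p , Fp , ps , _) = p , Fp , ps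

  TSEdge-target : ∀ {s t} → TSEdge F s t → TSVertex F t
  TSEdge-target (refl , p , Fp , _ , pt) = p , Fp , pt

  TSLe⇒≡⊎< : ∀ {s t} → TSLe F s t → s ≡ t ⊎ time s < time t
  TSLe⇒≡⊎< ε = inj₁ refl
  TSLe⇒≡⊎< (e ◅ r) with TSLe⇒≡⊎< r
  ... | inj₁ refl = inj₂ (TSEdge⇒< e)
  ... | inj₂ m<t  = inj₂ (<-trans (TSEdge⇒< e) m<t)

  TSLe⇒< : ∀ {s t} → TSLe F s t → s ≢ t → time s < time t
  TSLe⇒< r s≢t with TSLe⇒≡⊎< r
  ... | inj₁ s≡t = ⊥-elim (s≢t s≡t)
  ... | inj₂ s<t = s<t

  TSLe-antisym : Antisymmetric _≡_ (TSLe F)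
  TSLe-antisym st ts with TSLe⇒≡⊎< st | TSLe⇒≡⊎< ts
  ... | inj₁ s≡t | _         = s≡t
  ... | inj₂ _   | inj₁ t≡s  = sym t≡s
  ... | inj₂ s<t | inj₂ t<s  = ⊥-elim (<-asym s<t t<s)

  TSLe⇒TSEdge : ∀ {s t} → TSLe F s t → s ≢ t → time t ≡ suc (time s) → TSEdge F s t
  TSLe⇒TSEdge ε       s≢t _ = ⊥-elim (s≢t refl)
  TSLe⇒TSEdge (e ◅ r) s≢t t≡1+s with TSLe⇒≡⊎< r
  ... | inj₁ refl = e
  ... | inj₂ m<t  = ⊥-elim (<-irrefl (trans (proj₁ e) (sym t≡1+s)) m<t)

  interval-middle-edges : ∀ {x y d} → Interval F x y d → x ≢ d → d ≢ y →
    time y ≡ suc (suc (time x)) → TSEdge F x d × TSEdge F d y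
  interval-middle-edges {x} {y} {d} (_ , xd , dy) x≢d d≢y y≡2+x =
    TSLe⇒TSEdge xd x≢d d≡1+x , TSLe⇒TSEdge dy d≢y (trans y≡2+x (cong suc (sym d≡1+x)))
    where
      d≡1+x : time d ≡ suc (time x)
      d≡1+x = ≤-antisym (s≤s⁻¹ (subst (time d <_) y≡2+x (TSLe⇒< dy d≢y))) (TSLe⇒< xd x≢d)

  module _ {x c y} (xc : TSEdge F x c) (cy : TSEdge F c y) where

    source∈interval : Interval F x y x
    source∈interval = TSEdge-source xc , ε , xc ◅ cy ◅ ε

    middle∈interval : Interval F x y c
    middle∈interval = TSEdge-target xc , xc ◅ ε , cy ◅ ε

    target∈interval : Interval F x y y
    target∈interval = TSEdge-target cy , xc ◅ cy ◅ ε , ε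

    module _ {m₁ m₂} (D : DiamondWithMiddles (Interval F x y) (TSLe F) m₁ m₂) where

      bot≡source : bot D ≡ x
      bot≡source = TSLe-antisym (minimum D x source∈interval) (proj₁ (proj₂ (bot∈ D)))

      top≡target : top D ≡ y
      top≡target = TSLe-antisym (proj₂ (proj₂ (top∈ D))) (maximum D y target∈interval)

      middle-inner : IsInner D c
      middle-inner = middle∈interval
                   , (λ c≡bot → TSEdge⇒≢ xc (trans (sym bot≡source) (sym c≡bot)))
                   , (λ c≡top → TSEdge⇒≢ cy (trans c≡top top≡target))

    other-middle-edges : ∀ {d} → DiamondWithMiddles (Interval F x y) (TSLe F) c d →
      TSEdge F x d × TSEdge F d y
    other-middle-edges D =
      interval-middle-edges (m₂∈ D)
        (λ x≡d → bot≢m₂ D (trans (bot≡source D) x≡d))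
        (λ d≡y → top≢m₂ D (trans (top≡target D) (sym d≡y)))
        (trans (proj₁ cy) (cong suc (proj₁ xc)))

  NonemptyIntervalsAreDiamonds : ℕ → Set
  NonemptyIntervalsAreDiamonds k = ∀ (a b : Word n) →
    TSVertex F (a , k) → TSVertex F (b , suc (suc k)) →
    ∃[ z ] Interval F (a , k) (b , suc (suc k)) z →
    IsDiamond (Interval F (a , k) (b , suc (suc k))) (TSLe F)

  diamond-around : ∀ {k x c y} → NonemptyIntervalsAreDiamonds k →
    TSEdge F x c → TSEdge F c y → time x ≡ k → IsDiamond (Interval F x y) (TSLe F)
  diamond-around {x = a , _} {c , _} {b , _} diamonds xc@(refl , _) cy@(refl , _) refl =
    diamonds a b (TSEdge-source xc) (TSEdge-target cy) (_ , middle∈interval xc cy)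

  F'Rel-functional : ∀ {i} P {P′ P″} → F'Rel F i P P′ → F'Rel F i P P″ → P′ ≡ P″
  F'Rel-functional {i} P {P′} {P″} (P≈P′ , _ , _ , _ , _ , _ , Px , Py , Pc , P′d , D)
                                     (P≈P″ , _ , _ , _ , _ , _ , Px′ , Py′ , Pc′ , P″d′ , D′)
    with just-injective (trans (sym Px) Px′) | just-injective (trans (sym Py) Py′)
       | just-injective (trans (sym Pc) Pc′)
  ... | refl | refl | refl = at-injective agree
    where
      agree : ∀ j → at P′ j ≡ at P″ j
      agree j with j ≟ i
      ... | yes refl = trans P′d (trans (cong just (other-middle-unique TSLe-antisym D D′)) (sym P″d′))
      ... | no j≢i   = trans (sym (P≈P′ j j≢i)) (P≈P″ j j≢i)

  EdgeAt : Vec (Word n × ℕ) (suc h) → ℕ → Set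
  EdgeAt P k = ∃[ a ] ∃[ b ] (at P k ≡ just a × at P (suc k) ≡ just b × TSEdge F a b)

  module Paths (u v : Word n) where

    TSPath-at₀ : ∀ P → TSPath h F u v P → at P 0 ≡ just (u , 0)
    TSPath-at₀ P (P₀≡u , _) = trans (at-toℕ P fzero) (cong just P₀≡u)

    TSPath-atₕ : ∀ P → TSPath h F u v P → at P h ≡ just (v , h)
    TSPath-atₕ P (_ , Pₕ≡v , _) = trans (at-fromℕ h P) (cong just Pₕ≡v)

    TSPath-edge : ∀ P → TSPath h F u v P → ∀ {k a b} → k < h →
      at P k ≡ just a → at P (suc k) ≡ just b → TSEdge F a b
    TSPath-edge P (_ , _ , edges) k<h ea eb with fromℕ< k<h | toℕ-fromℕ< k<h
    ... | j | refl = subst₂ (TSEdge F) (just-injective (trans (sym (at-inject₁ P j)) ea))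
                                       (just-injective (trans (sym (at-toℕ P (fsuc j))) eb))
                                       (edges j)

    at⇒TSPath : ∀ P → at P 0 ≡ just (u , 0) → at P h ≡ just (v , h) →
      (∀ {k} → k < h → EdgeAt P k) →
      TSPath h F u v P
    at⇒TSPath P P₀≡u Pₕ≡v edges =
        just-injective (trans (sym (at-toℕ P fzero)) P₀≡u)
      , just-injective (trans (sym (at-fromℕ h P)) Pₕ≡v)
      , edge
      where
        edge : ∀ j → TSEdge F (lookup P (inject₁ j)) (lookup P (fsuc j))
        edge j with edges (toℕ<n j)
        ... | a , b , ea , eb , ab = subst₂ (TSEdge F)
                (just-injective (trans (sym ea) (at-inject₁ P j)))
                (just-injective (trans (sym eb) (at-toℕ P (fsuc j)))) ab

    TSPath-time : ∀ P → TSPath h F u v P → ∀ {k s} → at P k ≡ just s → time s ≡ k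
    TSPath-time P T {zero}  P₀≡s = cong time (just-injective (trans (sym P₀≡s) (TSPath-at₀ P T)))
    TSPath-time P T {suc k} Pₖ₊₁≡s with at-< P (<-trans (n<1+n k) (at-just⇒< P Pₖ₊₁≡s))
    ... | a , Pₖ≡a = trans (proj₁ (TSPath-edge P T k<h Pₖ≡a Pₖ₊₁≡s)) (cong suc (TSPath-time P T Pₖ≡a))
      where k<h = s≤s⁻¹ (at-just⇒< P Pₖ₊₁≡s)

    TSPath-replace : ∀ P {k x y d} → TSPath h F u v P → suc k < h →
      at P k ≡ just x → at P (suc (suc k)) ≡ just y → TSEdge F x d → TSEdge F d y →
      TSPath h F u v (replace P (suc k) d)
    TSPath-replace P {k} {x} {y} {d} T k+1<h Pₖ≡x Pₖ₊₂≡y xd dy =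
      at⇒TSPath P′ (trans (at-replace-≢ P d (λ ())) (TSPath-at₀ P T))
                (trans (at-replace-≢ P d (≢-sym (<⇒≢ k+1<h))) (TSPath-atₕ P T))
                edge
      where
        P′ = replace P (suc k) d
        P′ₖ₊₁≡d : at P′ (suc k) ≡ just d
        P′ₖ₊₁≡d = at-replace-≡ P d (s≤s (<⇒≤ k+1<h))
        edge : ∀ {j} → j < h → EdgeAt P′ j
        edge {j} j<h with j ≟ k | j ≟ suc k
        ... | yes refl | _ = x , d , trans (at-replace-≢ P d (≢-sym 1+n≢n)) Pₖ≡x , P′ₖ₊₁≡d , xd
        ... | _ | yes refl = d , y , P′ₖ₊₁≡d , trans (at-replace-≢ P d 1+n≢n) Pₖ₊₂≡y , dy
        ... | no j≢k | no j≢k+1 with at-< P (m≤n⇒m≤1+n j<h) | at-< P (s≤s j<h)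
        ...   | a , Pⱼ≡a | b , Pⱼ₊₁≡b =
                  a , b
                , trans (at-replace-≢ P d j≢k+1) Pⱼ≡a
                , trans (at-replace-≢ P d (λ j+1≡k+1 → j≢k (suc-injective j+1≡k+1))) Pⱼ₊₁≡b
                , TSPath-edge P T j<h Pⱼ≡a Pⱼ₊₁≡b

    flip-path : ∀ {k} → NonemptyIntervalsAreDiamonds k → suc (suc k) ≤ h →
      ∀ P → TSPath h F u v P → ∃[ P′ ] (TSPath h F u v P′ × F'Rel F (suc k) P P′)
    flip-path {k} diamonds k+2≤h P T
      with at-< P (m≤n⇒m≤1+n k<h) | at-< P (s≤s k<h) | at-< P (s≤s k+2≤h)
      where k<h = <⇒≤ k+2≤h
    ... | x , Pₖ≡x | c , Pₖ₊₁≡c | y , Pₖ₊₂≡y =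
        replace P (suc k) d
      , TSPath-replace P T k+2≤h Pₖ≡x Pₖ₊₂≡y (proj₁ xd,dy) (proj₂ xd,dy)
      , (λ j j≢k+1 → sym (at-replace-≢ P d j≢k+1))
      , x , y , c , d , refl , Pₖ≡x , Pₖ₊₂≡y , Pₖ₊₁≡c
      , at-replace-≡ P d (s≤s (<⇒≤ k+2≤h)) , D′
      where
        xc = TSPath-edge P T (<⇒≤ k+2≤h) Pₖ≡x Pₖ₊₁≡c
        cy = TSPath-edge P T k+2≤h Pₖ₊₁≡c Pₖ₊₂≡y
        D = proj₂ (proj₂ (diamond-around diamonds xc cy (TSPath-time P T Pₖ≡x)))
        partner = other-middle D (middle-inner xc cy D)
        d = proj₁ partner
        D′ = proj₂ partner
        xd,dy = other-middle-edges xc cy D′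

    ιTS-flip : ∀ {k} → IsFlipclass h u v F → NonemptyIntervalsAreDiamonds k → suc (suc k) ≤ h →
      ∀ p q → F p → Flip h u v (suc k) p q → F'Rel F (suc k) (ιTS p) (ιTS q)
    ιTS-flip {k} flipclass diamonds k+2≤h p q Fp flip@(_ , _ , _ , _ , p≈q , pₖ₊₁≢qₖ₊₁)
      with at-< p (m≤n⇒m≤1+n k<h) | at-< p (s≤s k<h) | at-< p (s≤s k+2≤h) | at-< q (s≤s k<h)
      where k<h = <⇒≤ k+2≤h
    ... | a , pₖ≡a | c , pₖ₊₁≡c | b , pₖ₊₂≡b | d , qₖ₊₁≡d =
        (λ j j≢k+1 → at-ιTS-cong p q (p≈q j j≢k+1))
      , (a , k) , (b , suc (suc k)) , (c , suc k) , (d , suc k) , refl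
      , at-ιTS-just p pₖ≡a , at-ιTS-just p pₖ₊₂≡b , at-ιTS-just p pₖ₊₁≡c , at-ιTS-just q qₖ₊₁≡d
      , diamond-with-middles D (middle-inner xc cy D) (middle-inner xd dy D) c≢d
      where
        Fq = flipclass-closed flipclass Fp flip
        xc : TSEdge F (a , k) (c , suc k)
        xc = refl , p , Fp , pₖ≡a , pₖ₊₁≡c
        cy : TSEdge F (c , suc k) (b , suc (suc k))
        cy = refl , p , Fp , pₖ₊₁≡c , pₖ₊₂≡b
        xd : TSEdge F (a , k) (d , suc k)
        xd = refl , q , Fq , trans (sym (p≈q k (≢-sym 1+n≢n))) pₖ≡a , qₖ₊₁≡d
        dy : TSEdge F (d , suc k) (b , suc (suc k))
        dy = refl , q , Fq , qₖ₊₁≡d , trans (sym (p≈q (suc (suc k)) 1+n≢n)) pₖ₊₂≡b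
        D = proj₂ (proj₂ (diamond-around diamonds xc cy refl))
        c≢d : (c , suc k) ≢ (d , suc k)
        c≢d refl = pₖ₊₁≢qₖ₊₁ (trans pₖ₊₁≡c (sym qₖ₊₁≡d))

lemma5p6 : (n h : ℕ) (u v : Word n) → IsPerm u → IsPerm v → BruhatLt u v →
    (F : Vec (Word n) (suc h) → Set) → IsFlipclass h u v F →
    (∀ (i : ℕ) → 1 ≤ i → suc i ≤ h → ∀ (a b : Word n) →
      TSVertex F (a , i ∸ 1) → TSVertex F (b , suc i) →
      ∃[ z ] Interval F (a , i ∸ 1) (b , suc i) z →
      IsDiamond (Interval F (a , i ∸ 1) (b , suc i)) (TSLe F)) →
    ∀ (i : ℕ) → 1 ≤ i → suc i ≤ h →
      -- f'_i is well defined on the set of paths of length h from (u,0) to (v,h) in TS_F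
      ((∀ P → TSPath h F u v P → ∃[ P' ] (TSPath h F u v P' × F'Rel F i P P')) ×
       (∀ P P' P'' → TSPath h F u v P → F'Rel F i P P' → F'Rel F i P P'' → P' ≡ P'')) ×
      -- i_{TS_F} ∘ f_i = f'_i ∘ i_{TS_F} on F
      (∀ p q → F p → Flip h u v i p q → F'Rel F i (ιTS p) (ιTS q))
lemma5p6 n h u v _ _ _ F _         _        zero    ()        _
lemma5p6 n h u v _ _ _ F flipclass diamonds (suc k) 1≤1+k k+2≤h =
    ((λ P → flip-path diamondsₖ k+2≤h P) , (λ P _ _ _ → F'Rel-functional P))
  , ιTS-flip flipclass diamondsₖ k+2≤h
  where
    open TimeSupport F
    open Paths u v
    diamondsₖ : NonemptyIntervalsAreDiamonds k
    diamondsₖ = diamonds (suc k) 1≤1+k k+2≤h
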